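{- Let $G$ be a graph with $5$ or more vertices that contains a cut-vertex $v$ such that $G-v$ has at least three components, at least two of which are paths. Then $F(G)\geq 3$.
   Context: All graphs are finite and simple. A vertex $v$ is a cut-vertex of $G$ if $G-v$ has more components than $G$. Given a graph $G$ and a set $S\subseteq V(G)$, the forcing rule is: if a vertex $v\in S$ has exactly one neighbor $u$ not in $S$, then $u$ is added to $S$. A set $S$ is a failed zero-forcing set of $G$ if repeated application of the forcing rule starting from $S$ does not result in all vertices of $G$ being in $S$. The failed zero-forcing number $F(G)$ is the maximum cardinality of a failed zero-forcing set of $G$. -}

module Defs where

open import Data.Nat using (ℕ; zero; suc; _≤_; _<_)
open import Data.Bool using (Bool; true; false)
open import Data.Fin using (Fin; toℕ; punchIn)
open import Data.Fin.Subset using (Subset; _∈_; _∉_; ∣_∣)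
open import Data.Product using (Σ; ∃; ∃-syntax; _×_; _,_)
open import Data.Sum using (_⊎_)
open import Relation.Binary.PropositionalEquality using (_≡_; _≢_)
open import Relation.Nullary using (¬_)
open import Function.Bundles using (_⇔_)

record Graph (n : ℕ) : Set where
  field
    adj   : Fin n → Fin n → Bool
    sym   : ∀ u w → adj u w ≡ adj w u
    irr   : ∀ u → adj u u ≡ false
open Graph public

_-ᵥ_ : ∀ {m} → Graph (suc m) → Fin (suc m) → Graph m
adj (G -ᵥ v) i j = adj G (punchIn v i) (punchIn v j)
sym (G -ᵥ v) i j = sym G (punchIn v i) (punchIn v j)
irr (G -ᵥ v) i   = irr G (punchIn v i)

data Reach {n} (G : Graph n) : Fin n → Fin n → Set where
  here : ∀ {u} → Reach G u u
  step : ∀ {u w x} → adj G u w ≡ true → Reach G w x → Reach G u x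

HasComponents : ∀ {n} → Graph n → ℕ → Set
HasComponents {n} G k =
  Σ (Fin k → Fin n) λ r →
    (∀ i j → Reach G (r i) (r j) → i ≡ j) × (∀ x → ∃[ i ] Reach G (r i) x)

IsCutVertex : ∀ {m} → Graph (suc m) → Fin (suc m) → Set
IsCutVertex G v =
  ∃[ k ] ∃[ k' ] (HasComponents G k × HasComponents (G -ᵥ v) k' × k < k')

ComponentIsPath : ∀ {n} → Graph n → Fin n → Set
ComponentIsPath {n} G a =
  Σ ℕ λ t → 1 ≤ t × Σ (Fin t → Fin n) λ f →
    (∀ i j → f i ≡ f j → i ≡ j) ×
    (∀ i → Reach G a (f i)) ×
    (∀ x → Reach G a x → ∃[ i ] f i ≡ x) ×
    (∀ i j → (adj G (f i) (f j) ≡ true) ⇔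
               (toℕ j ≡ suc (toℕ i) ⊎ toℕ i ≡ suc (toℕ j)))

-- The final set obtained by repeatedly applying the forcing rule from S
-- (the least set containing S closed under the rule: if w is in it and
-- every neighbour of w other than u is in it, then the neighbour u is).
data Forced {n} (G : Graph n) (S : Subset n) : Fin n → Set where
  init  : ∀ {u} → u ∈ S → Forced G S u
  force : ∀ {w u} → Forced G S w → adj G w u ≡ true →
          (∀ x → adj G w x ≡ true → x ≢ u → Forced G S x) →
          Forced G S u

IsFailedZeroForcingSet : ∀ {n} → Graph n → Subset n → Set
IsFailedZeroForcingSet G S = ∃[ u ] ¬ Forced G S u

IsFailedZeroForcingNumber : ∀ {n} → Graph n → ℕ → Set
IsFailedZeroForcingNumber {n} G k =
  (∃[ S ] (IsFailedZeroForcingSet G S × ∣ S ∣ ≡ k)) ×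
  (∀ (S : Subset n) → IsFailedZeroForcingSet G S → ∣ S ∣ ≤ k)

-- Label the vertices 0 (v), 1 (the component of a in G - v), 2 (that of b)
-- and 3 (the rest), so that an edge avoiding v joins equal labels.  For a set
-- P of nonzero labels, the vertices labelled in P form a fort (no vertex
-- outside has exactly one neighbour inside) as soon as v does not have exactly
-- one neighbour there, and the complement of a nonempty fort is a failed
-- zero-forcing set.  If some class contains no neighbour of v, it alone is
-- such a fort, and its complement contains v and the two other classes.
-- Otherwise, as G has at least five vertices, two vertices x ≠ y share a
-- class, and the union of the other two classes is a fort whose complement
-- contains v, x and y.
{-# OPTIONS --safe #-}
module Submission where

open import Defs
open import Data.Nat using (suc; _≤_; z≤n; s≤s)
open import Data.Nat.Properties using (≤-trans)
open import Data.Fin using (Fin; zero; suc; punchIn; punchOut; _≟_)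
open import Data.Fin.Properties
  using (any?; pigeonhole; <⇒≢; punchInᵢ≢i; punchOut-cong; punchOut-punchIn; punchIn-punchOut)
open import Data.Fin.Subset using (Subset; _∈_; _∉_; ∣_∣; _-_; ∁)
open import Data.Fin.Subset.Properties using (x∈p⇒∣p-x∣<∣p∣; x∈p∧x≢y⇒x∈p-y; x∈∁p⇒x∉p; x∉p⇒x∈∁p)
open import Data.Vec using (tabulate)
open import Data.Vec.Properties using (lookup∘tabulate; []=⇒lookup; lookup⇒[]=)
open import Data.Bool using (Bool; true; false) renaming (_≟_ to _≟ᵇ_)
open import Data.Product using (_×_; ∃-syntax; _,_)
open import Data.Sum using (_⊎_; inj₁; inj₂)
open import Function using (_∘_)
open import Function.Bundles using (_⇔_; mk⇔)
open import Relation.Binary.PropositionalEquality as ≡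
  using (_≡_; _≢_; refl; trans; cong; cong₂; subst; subst₂)
open import Relation.Nullary using (¬_; yes; no; does; contradiction; ¬?)
open import Relation.Nullary.Decidable
  using (dec-true; dec-false; does-⇔; decidable-stable; _×-dec_)
open import Level using (0ℓ)
open import Relation.Unary using (Pred; Decidable)

module _ {n} (G : Graph n) where

  Reach-snoc : ∀ {u w x} → Reach G u w → adj G w x ≡ true → Reach G u x
  Reach-snoc here       e′ = step e′ here
  Reach-snoc (step e r) e′ = step e (Reach-snoc r e′)

  Reach-⇔-adj : ∀ {u x y} → adj G x y ≡ true → Reach G u x ⇔ Reach G u y
  Reach-⇔-adj {x = x} {y} e =
    mk⇔ (λ r → Reach-snoc r e) (λ r → Reach-snoc r (trans (Graph.sym G y x) e))

ComponentIsPath⇒Reach? : ∀ {n} {G : Graph n} {a} → ComponentIsPath G a → Decidable (Reach G a)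
ComponentIsPath⇒Reach? {G = G} {a} (_ , _ , f , _ , reach-f , onto-f , _) y with any? (λ i → f i ≟ y)
... | yes (i , fi≡y) = yes (subst (Reach G a) fi≡y (reach-f i))
... | no  ∄i         = no (∄i ∘ onto-f y)

decSubset : ∀ {n ℓ} {P : Pred (Fin n) ℓ} → Decidable P → Subset n
decSubset P? = tabulate (does ∘ P?)

module _ {n ℓ} {P : Pred (Fin n) ℓ} (P? : Decidable P) where

  ∈-decSubset⁺ : ∀ {x} → P x → x ∈ decSubset P?
  ∈-decSubset⁺ {x} px = lookup⇒[]= x _ (trans (lookup∘tabulate (does ∘ P?) x) (dec-true (P? x) px))

  ∈-decSubset⁻ : ∀ {x} → x ∈ decSubset P? → P x
  ∈-decSubset⁻ {x} x∈ with P? x | trans (≡.sym ([]=⇒lookup x∈)) (lookup∘tabulate (does ∘ P?) x)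
  ... | yes px | _ = px
  ... | no _   | ()

3≤∣p∣ : ∀ {n} {p : Subset n} {x y z} → x ∈ p → y ∈ p → z ∈ p →
        x ≢ y → x ≢ z → y ≢ z → 3 ≤ ∣ p ∣
3≤∣p∣ {p = p} {x} {y} {z} x∈p y∈p z∈p x≢y x≢z y≢z =
  ≤-trans (s≤s 2≤∣p-x∣) (x∈p⇒∣p-x∣<∣p∣ x∈p)
  where
  1≤∣p-x-y∣ : 1 ≤ ∣ p - x - y ∣
  1≤∣p-x-y∣ = ≤-trans (s≤s z≤n)
    (x∈p⇒∣p-x∣<∣p∣ (x∈p∧x≢y⇒x∈p-y (x∈p∧x≢y⇒x∈p-y z∈p (x≢z ∘ ≡.sym)) (y≢z ∘ ≡.sym)))
  2≤∣p-x∣ : 2 ≤ ∣ p - x ∣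
  2≤∣p-x∣ = ≤-trans (s≤s 1≤∣p-x-y∣) (x∈p⇒∣p-x∣<∣p∣ (x∈p∧x≢y⇒x∈p-y y∈p (x≢y ∘ ≡.sym)))

module _ {n} (G : Graph n) where

  Fort : Subset n → Set
  Fort T = ∀ {w u} → w ∉ T → u ∈ T → adj G w u ≡ true →
           ∃[ x ] (x ∈ T × adj G w x ≡ true × x ≢ u)

  Forced-∁-fort : ∀ {T u} → Fort T → Forced G (∁ T) u → u ∉ T
  Forced-∁-fort fort (init u∈∁T) = x∈∁p⇒x∉p u∈∁T
  Forced-∁-fort fort (force fw w~u others) u∈T
    with x , x∈T , w~x , x≢u ← fort (Forced-∁-fort fort fw) u∈T w~u
    = Forced-∁-fort fort (others x w~x x≢u) x∈T

  fort⇒failed : ∀ {T u} → Fort T → u ∈ T → IsFailedZeroForcingSet G (∁ T)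
  fort⇒failed fort u∈T = _ , λ forced → Forced-∁-fort fort forced u∈T

fresh-label : (i k : Fin 4) → ∃[ j ] (j ≢ zero × j ≢ i × j ≢ k)
fresh-label i k with i ≟ suc zero | k ≟ suc zero
... | no i≢1 | no k≢1 = suc zero , (λ ()) , i≢1 ∘ ≡.sym , k≢1 ∘ ≡.sym
... | yes refl | _ with k ≟ suc (suc zero)
...   | no k≢2   = suc (suc zero) , (λ ()) , (λ ()) , k≢2 ∘ ≡.sym
...   | yes refl = suc (suc (suc zero)) , (λ ()) , (λ ()) , (λ ())
fresh-label i k | no _ | yes refl with i ≟ suc (suc zero)
...   | no i≢2   = suc (suc zero) , (λ ()) , i≢2 ∘ ≡.sym , (λ ())
...   | yes refl = suc (suc (suc zero)) , (λ ()) , (λ ()) , (λ ())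

record CutPartition {n} (G : Graph n) (v : Fin n) : Set where
  field
    part      : Fin n → Fin 4
    part≡0⇒v : ∀ {x} → part x ≡ zero → x ≡ v
    part-adj  : ∀ {x y} → adj G x y ≡ true → part x ≡ zero ⊎ part y ≡ zero ⊎ part x ≡ part y
    part-onto : ∀ i → ∃[ x ] part x ≡ i

module _ {n} {G : Graph n} {v : Fin n} (cp : CutPartition G v) where
  open CutPartition cp

  part-v : part v ≡ zero
  part-v with x , part-x≡0 ← part-onto zero with refl ← part≡0⇒v part-x≡0 = part-x≡0

  part-≢ : ∀ {x y} → part x ≢ part y → x ≢ y
  part-≢ ne = ne ∘ cong part

  VNeighbourIn : Fin 4 → Set
  VNeighbourIn i = ∃[ u ] (part u ≡ i × adj G v u ≡ true)

  VNeighbourIn? : Decidable VNeighbourIn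
  VNeighbourIn? i = any? λ u → (part u ≟ i) ×-dec (adj G v u ≟ᵇ true)

  NoUniqueVNeighbour : Pred (Fin 4) 0ℓ → Set
  NoUniqueVNeighbour P =
    ∀ {u} → P (part u) → adj G v u ≡ true → ∃[ x ] (P (part x) × adj G v x ≡ true × x ≢ u)

  parts : {P : Pred (Fin 4) 0ℓ} → Decidable P → Subset n
  parts P? = decSubset (P? ∘ part)

  parts-fort : {P : Pred (Fin 4) 0ℓ} (P? : Decidable P) → ¬ P zero → NoUniqueVNeighbour P →
               Fort G (parts P?)
  parts-fort {P} P? ¬P0 second {w} {u} w∉T u∈T w~u with part-adj w~u
  ... | inj₁ part-w≡0 with refl ← part≡0⇒v part-w≡0
    with x , Px , v~x , x≢u ← second (∈-decSubset⁻ (P? ∘ part) u∈T) w~u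
    = x , ∈-decSubset⁺ (P? ∘ part) Px , v~x , x≢u
  ... | inj₂ (inj₁ part-u≡0) = contradiction (subst P part-u≡0 (∈-decSubset⁻ (P? ∘ part) u∈T)) ¬P0
  ... | inj₂ (inj₂ part-w≡part-u) =
    contradiction (∈-decSubset⁺ (P? ∘ part) (subst P (≡.sym part-w≡part-u) (∈-decSubset⁻ (P? ∘ part) u∈T)))
                  w∉T

  parts-failed : {P : Pred (Fin 4) 0ℓ} (P? : Decidable P) → ¬ P zero → NoUniqueVNeighbour P →
                 ∀ {i} → P i → IsFailedZeroForcingSet G (∁ (parts P?))
  parts-failed {P} P? ¬P0 second {i} Pi with u , part-u≡i ← part-onto i =
    fort⇒failed G (parts-fort P? ¬P0 second) (∈-decSubset⁺ (P? ∘ part) (subst P (≡.sym part-u≡i) Pi))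

  3≤∣∁parts∣ : {P : Pred (Fin 4) 0ℓ} (P? : Decidable P) → ¬ P zero →
               ∀ {x y} → x ≢ y → part x ≢ zero → part y ≢ zero → ¬ P (part x) → ¬ P (part y) →
               3 ≤ ∣ ∁ (parts P?) ∣
  3≤∣∁parts∣ {P} P? ¬P0 x≢y x≢0 y≢0 ¬Px ¬Py =
    3≤∣p∣ (∉parts (¬P0 ∘ subst P part-v)) (∉parts ¬Px) (∉parts ¬Py) (v≢ x≢0) (v≢ y≢0) x≢y
    where
    ∉parts : ∀ {x} → ¬ P (part x) → x ∈ ∁ (parts P?)
    ∉parts ¬Px = x∉p⇒x∈∁p (¬Px ∘ ∈-decSubset⁻ (P? ∘ part))
    v≢ : ∀ {x} → part x ≢ zero → v ≢ x
    v≢ x≢0 v≡x = x≢0 (trans (cong part (≡.sym v≡x)) part-v)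

  failed-∁part : ∀ j → j ≢ zero → ¬ VNeighbourIn j →
                 ∃[ S ] (IsFailedZeroForcingSet G S × 3 ≤ ∣ S ∣)
  failed-∁part j j≢0 no-v-neighbour
    with j₁ , j₁≢0 , j₁≢j , _ ← fresh-label j j
    with j₂ , j₂≢0 , j₂≢j , j₂≢j₁ ← fresh-label j j₁
    with x₁ , refl ← part-onto j₁
    with x₂ , refl ← part-onto j₂
    = ∁ (parts (_≟ j))
    , parts-failed (_≟ j) (j≢0 ∘ ≡.sym) (λ {w} Pw v~w → contradiction (w , Pw , v~w) no-v-neighbour) refl
    , 3≤∣∁parts∣ (_≟ j) (j≢0 ∘ ≡.sym) (part-≢ (j₂≢j₁ ∘ ≡.sym)) j₁≢0 j₂≢0 j₁≢j j₂≢j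

  failed-∁two-parts : (∀ i → i ≢ zero → VNeighbourIn i) → ∀ {x y} → x ≢ y → part x ≡ part y →
                      ∃[ S ] (IsFailedZeroForcingSet G S × 3 ≤ ∣ S ∣)
  failed-∁two-parts meets {x} {y} x≢y part-x≡part-y
    with j , j≢0 , j≢k , _ ← fresh-label (part x) (part x)
    = ∁ (parts P?)
    , parts-failed P? (λ (0≢0 , _) → 0≢0 refl) second (j≢0 , j≢k)
    , 3≤∣∁parts∣ P? (λ (0≢0 , _) → 0≢0 refl) x≢y k≢0 (k≢0 ∘ trans part-x≡part-y)
                 (λ (_ , ≢k) → ≢k refl) (λ (_ , ≢k) → ≢k (≡.sym part-x≡part-y))
    where
    k : Fin 4
    k = part x
    k≢0 : k ≢ zero
    k≢0 part-x≡0 =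
      x≢y (trans (part≡0⇒v part-x≡0) (≡.sym (part≡0⇒v (trans (≡.sym part-x≡part-y) part-x≡0))))
    P : Pred (Fin 4) 0ℓ
    P i = i ≢ zero × i ≢ k
    P? : Decidable P
    P? i = ¬? (i ≟ zero) ×-dec ¬? (i ≟ k)
    second : NoUniqueVNeighbour P
    second {w} _ _ with j′ , j′≢0 , j′≢i , j′≢k ← fresh-label (part w) k
                   with w′ , refl , v~w′ ← meets j′ j′≢0
      = w′ , (j′≢0 , j′≢k) , v~w′ , part-≢ j′≢i

  CutPartition⇒failed : 5 ≤ n → ∃[ S ] (IsFailedZeroForcingSet G S × 3 ≤ ∣ S ∣)
  CutPartition⇒failed 5≤n with any? (λ j → ¬? (j ≟ zero) ×-dec ¬? (VNeighbourIn? j))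
  ... | yes (j , j≢0 , ¬meets) = failed-∁part j j≢0 ¬meets
  ... | no ∄j with x , y , x<y , part-x≡part-y ← pigeonhole 5≤n part
    = failed-∁two-parts meets (<⇒≢ x<y) part-x≡part-y
    where
    meets : ∀ i → i ≢ zero → VNeighbourIn i
    meets i i≢0 = decidable-stable (VNeighbourIn? i) λ ¬meets → ∄j (i , i≢0 , ¬meets)

classify : Bool → Bool → Fin 4
classify true  _     = suc zero
classify false true  = suc (suc zero)
classify false false = suc (suc (suc zero))

classify≢0 : ∀ p q → classify p q ≢ zero
classify≢0 true  _     ()
classify≢0 false true  ()
classify≢0 false false ()

module Sides {m} (G : Graph (suc m)) (v : Fin (suc m)) {a b : Fin m}
         (a? : Decidable (Reach (G -ᵥ v) a)) (b? : Decidable (Reach (G -ᵥ v) b)) where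

  side : Fin m → Fin 4
  side y = classify (does (a? y)) (does (b? y))

  side-adj : ∀ {y z} → adj (G -ᵥ v) y z ≡ true → side y ≡ side z
  side-adj {y} {z} e = cong₂ classify (does-⇔ (Reach-⇔-adj _ e) (a? y) (a? z))
                                        (does-⇔ (Reach-⇔-adj _ e) (b? y) (b? z))

  label : Fin (suc m) → Fin 4
  label x with v ≟ x
  ... | yes _   = zero
  ... | no v≢x = side (punchOut v≢x)

  label-v : label v ≡ zero
  label-v with v ≟ v
  ... | yes _   = refl
  ... | no v≢v = contradiction refl v≢v

  label-punchIn : ∀ y → label (punchIn v y) ≡ side y
  label-punchIn y with v ≟ punchIn v y
  ... | yes v≡y′ = contradiction (≡.sym v≡y′) (punchInᵢ≢i v y)
  ... | no v≢y′  = cong side (trans (punchOut-cong v refl) (punchOut-punchIn v))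

  label≡0⇒v : ∀ {x} → label x ≡ zero → x ≡ v
  label≡0⇒v {x} label-x≡0 with v ≟ x
  ... | yes v≡x = ≡.sym v≡x
  ... | no v≢x  = contradiction label-x≡0 (classify≢0 _ _)

  label-adj : ∀ {x y} → adj G x y ≡ true → label x ≡ zero ⊎ label y ≡ zero ⊎ label x ≡ label y
  label-adj {x} {y} e with v ≟ x | v ≟ y
  ... | yes _  | _      = inj₁ refl
  ... | no _   | yes _  = inj₂ (inj₁ refl)
  ... | no v≢x | no v≢y = inj₂ (inj₂ (side-adj (subst₂ (λ x′ y′ → adj G x′ y′ ≡ true)
                                         (≡.sym (punchIn-punchOut v≢x)) (≡.sym (punchIn-punchOut v≢y)) e)))

  separated⇒CutPartition : ∀ {c} → ¬ Reach (G -ᵥ v) a b → ¬ Reach (G -ᵥ v) a c → ¬ Reach (G -ᵥ v) b c →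
                           CutPartition G v
  separated⇒CutPartition {c} ¬a~b ¬a~c ¬b~c = record
    { part = label ; part≡0⇒v = label≡0⇒v ; part-adj = label-adj ; part-onto = label-onto }
    where
    label-onto : ∀ i → ∃[ x ] label x ≡ i
    label-onto zero                   = v , label-v
    label-onto (suc zero)             = punchIn v a , trans (label-punchIn a)
                                         (cong₂ classify (dec-true (a? a) here) refl)
    label-onto (suc (suc zero))       = punchIn v b , trans (label-punchIn b)
                                         (cong₂ classify (dec-false (a? b) ¬a~b) (dec-true (b? b) here))
    label-onto (suc (suc (suc zero))) = punchIn v c , trans (label-punchIn c)
                                         (cong₂ classify (dec-false (a? c) ¬a~c) (dec-false (b? c) ¬b~c))

open Sides using (separated⇒CutPartition)

lemma2p6 : ∀ {m} (G : Graph (suc m)) (v : Fin (suc m)) → 5 ≤ suc m →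
    IsCutVertex G v →
    (∃[ a ] ∃[ b ] ∃[ c ]
       (¬ Reach (G -ᵥ v) a b × ¬ Reach (G -ᵥ v) a c × ¬ Reach (G -ᵥ v) b c ×
        ComponentIsPath (G -ᵥ v) a × ComponentIsPath (G -ᵥ v) b)) →
    ∀ k → IsFailedZeroForcingNumber G k → 3 ≤ k
lemma2p6 G v 5≤n _ (a , b , c , ¬a~b , ¬a~c , ¬b~c , path-a , path-b) k (_ , maximal) =
  let S , S-failed , 3≤∣S∣ = CutPartition⇒failed (separated⇒CutPartition G v
                               (ComponentIsPath⇒Reach? path-a) (ComponentIsPath⇒Reach? path-b)
                               ¬a~b ¬a~c ¬b~c) 5≤n
  in ≤-trans 3≤∣S∣ (maximal S S-failed)
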